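{- $(\mathbb{GS},+)$ is a commutative monoid: for all $G,H,J\in\mathbb{GS}$ we have $G+H\in\mathbb{GS}$, $G+H=H+G$, $(G+H)+J=G+(H+J)$, and $G+0=0+G=G$, where $0=\langle\emptyset^0\mid\emptyset^0\rangle$.
   Context: A scoring game is written $G=\langle G^{\mathcal L}\mid G^{\mathcal R}\rangle$, where each of $G^{\mathcal L}$ (the Left options) and $G^{\mathcal R}$ (the Right options) is either a finite nonempty set of scoring games or an atom $\emptyset^{s}$ with $s\in\mathbb R$; game trees are finite. An atom $\emptyset^s$ on a side means that the corresponding player, if to move, has no move and the game ends with score $s$. $G$ is left-atomic if $G^{\mathcal L}$ is an atom, right-atomic if $G^{\mathcal R}$ is an atom. The followers of $G$ are $G$, its options, their options, etc. An atom occurring in $G$ is an atom of $G$ or of any follower of $G$. A game $G$ is guaranteed if for every follower $K$ of $G$: if $K^{\mathcal L}=\emptyset^\ell$ then $\ell\le s$ for every atom $\emptyset^s$ occurring in $K$, and if $K^{\mathcal R}=\emptyset^r$ then $s\le r$ for every atom $\emptyset^s$ occurring in $K$. $\mathbb{GS}$ denotes the class of guaranteed games. The disjunctive sum $G+H$ is defined recursively: its Left options are all $G^L+H$ ($G^L\in G^{\mathcal L}$) and all $G+H^L$ ($H^L\in H^{\mathcal L}$), except that if both $G$ and $H$ are left-atomic with $G^{\mathcal L}=\emptyset^{\ell_1}$, $H^{\mathcal L}=\emptyset^{\ell_2}$, then $(G+H)^{\mathcal L}=\emptyset^{\ell_1+\ell_2}$; Right options are defined symmetrically. -}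

module Defs where

open import Level using (0ℓ)
open import Data.Nat using (ℕ; suc; _+_)
open import Data.Fin using (Fin; splitAt)
open import Data.Sum using (_⊎_; inj₁; inj₂; [_,_]′)
open import Data.Product using (Σ; ∃; _×_; _,_)
open import Relation.Binary.PropositionalEquality using (_≡_)
open import Relation.Binary.Structures using (IsTotalOrder)

-- The paper uses real-number scores.  Agda's standard library has
-- no reals, so we work over an arbitrary totally ordered abelian group
-- (ℝ with + and ≤ is an instance).  Only +, 0 and ≤ are used.
record ScoreGroup : Set₁ where
  infixl 6 _⊹_
  infix 4 _≤_
  field
    S        : Set
    _⊹_      : S → S → S
    0#       : S
    -_       : S → S
    _≤_      : S → S → Set
    ⊹-assoc  : ∀ x y z → (x ⊹ y) ⊹ z ≡ x ⊹ (y ⊹ z)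
    ⊹-comm   : ∀ x y → x ⊹ y ≡ y ⊹ x
    ⊹-idˡ    : ∀ x → 0# ⊹ x ≡ x
    ⊹-invˡ   : ∀ x → (- x) ⊹ x ≡ 0#
    ≤-isTotalOrder : IsTotalOrder _≡_ _≤_
    ⊹-monoˡ-≤ : ∀ z {x y} → x ≤ y → x ⊹ z ≤ y ⊹ z

module Games (SG : ScoreGroup) where
  open ScoreGroup SG

  -- Each side is either an atom ∅ˢ, or a
  -- finite nonempty family of options, indexed by Fin (suc n).
  -- (The paper's option *sets* are compared up to set equality, see _≅_.)
  mutual
    data Game : Set where
      ⟨_∣_⟩ : Side → Side → Game

    data Side : Set where
      atom : S → Side
      opts : (n : ℕ) → (Fin (suc n) → Game) → Side

  leftSide : Game → Side
  leftSide ⟨ l ∣ r ⟩ = l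

  rightSide : Game → Side
  rightSide ⟨ l ∣ r ⟩ = r

  𝟎 : Game
  𝟎 = ⟨ atom 0# ∣ atom 0# ⟩

  infixl 6 _+G_
  mutual
    _+G_ : Game → Game → Game
    ⟨ a ∣ b ⟩ +G ⟨ c ∣ d ⟩ = ⟨ sumSide ⟨ a ∣ b ⟩ ⟨ c ∣ d ⟩ a c ∣ sumSide ⟨ a ∣ b ⟩ ⟨ c ∣ d ⟩ b d ⟩

    sumSide : Game → Game → Side → Side → Side
    sumSide G H (atom x)   (atom y)   = atom (x ⊹ y)
    sumSide G H (opts n f) (atom y)   = opts n (λ i → f i +G H)
    sumSide G H (atom x)   (opts m g) = opts m (λ j → G +G g j)
    sumSide G H (opts n f) (opts m g) =
      opts (n + suc m) (λ k → [ (λ i → f i +G H) , (λ j → G +G g j) ]′ (splitAt (suc n) k))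

  mutual
    data _≅_ : Game → Game → Set where
      ≅-game : ∀ {a b c d} → a ≅S c → b ≅S d → ⟨ a ∣ b ⟩ ≅ ⟨ c ∣ d ⟩

    data _≅S_ : Side → Side → Set where
      ≅-atom : ∀ {x y} → x ≡ y → atom x ≅S atom y
      ≅-opts : ∀ {n m f g} →
               (∀ i → ∃ λ j → f i ≅ g j) →
               (∀ j → ∃ λ i → f i ≅ g j) →
               opts n f ≅S opts m g

  data OccursIn (s : S) : Game → Set where
    here-L : ∀ {r} → OccursIn s ⟨ atom s ∣ r ⟩
    here-R : ∀ {l} → OccursIn s ⟨ l ∣ atom s ⟩
    in-L   : ∀ {n f r} (i : Fin (suc n)) → OccursIn s (f i) → OccursIn s ⟨ opts n f ∣ r ⟩
    in-R   : ∀ {l n f} (i : Fin (suc n)) → OccursIn s (f i) → OccursIn s ⟨ l ∣ opts n f ⟩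

  data Follower : Game → Game → Set where
    self   : ∀ {G} → Follower G G
    via-L  : ∀ {K n f r} (i : Fin (suc n)) → Follower K (f i) → Follower K ⟨ opts n f ∣ r ⟩
    via-R  : ∀ {K l n f} (i : Fin (suc n)) → Follower K (f i) → Follower K ⟨ l ∣ opts n f ⟩

  Guaranteed : Game → Set
  Guaranteed G = ∀ K → Follower K G →
      (∀ ℓ → leftSide K ≡ atom ℓ → ∀ s → OccursIn s K → ℓ ≤ s)
    × (∀ r → rightSide K ≡ atom r → ∀ s → OccursIn s K → s ≤ r)

-- The options of G + H are exactly the games X + H and G + Y for options X of
-- G and Y of H, and a side of G + H is an atom only when both corresponding
-- sides are, with the sum of their scores.  So commutativity, associativity
-- and the unit laws for + reduce to the same laws for the options and for the
-- score group.  For guaranteedness, every atom of G + H is a sum s₁ + s₂ of an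
-- atom of G and an atom of H; if G + H is left-atomic with score ℓ₁ + ℓ₂,
-- then ℓ₁ ≤ s₁ and ℓ₂ ≤ s₂ because G and H are guaranteed, and ℓ₁ + ℓ₂ ≤ s₁ + s₂
-- follows by monotonicity of the score addition.
module Submission where

open import Defs
open import Data.Product using (_×_; _,_; ∃; ∃₂; proj₁; proj₂)
open import Data.Nat using (suc)
open import Data.Fin using (Fin; zero; splitAt; _↑ˡ_; _↑ʳ_)
open import Data.Fin.Properties using (splitAt-↑ˡ; splitAt-↑ʳ)
open import Data.Sum using (_⊎_; inj₁; inj₂; [_,_]′)
open import Function using (id; flip)
open import Relation.Binary.PropositionalEquality using (_≡_; refl; trans; cong; subst; subst₂)
open import Relation.Binary.Structures using (IsTotalOrder)

module GameSum (SG : ScoreGroup) where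
  open ScoreGroup SG
  open Games SG

  ⊹-identityʳ : ∀ x → x ⊹ 0# ≡ x
  ⊹-identityʳ x = trans (⊹-comm x 0#) (⊹-idˡ x)

  ⊹-mono-≤ : ∀ {x x′ y y′} → x ≤ x′ → y ≤ y′ → x ⊹ y ≤ x′ ⊹ y′
  ⊹-mono-≤ {x} {x′} {y} {y′} x≤x′ y≤y′ =
    IsTotalOrder.trans ≤-isTotalOrder (⊹-monoˡ-≤ y x≤x′)
      (subst₂ _≤_ (⊹-comm y x′) (⊹-comm y′ x′) (⊹-monoˡ-≤ x′ y≤y′))

  infix 4 _∈_

  data _∈_ : Game → Side → Set where
    option : ∀ {n f} (i : Fin (suc n)) → f i ∈ opts n f

  All : (Game → Set) → Side → Set
  All P x = ∀ {X} → X ∈ x → P X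

  module _ (P : Game → Set) (step : ∀ {l r} → All P l → All P r → P ⟨ l ∣ r ⟩) where
    mutual
      Game-ind : ∀ G → P G
      Game-ind ⟨ l ∣ r ⟩ = step (All-ind l) (All-ind r)

      All-ind : ∀ x → All P x
      All-ind (opts n f) (option i) = Game-ind (f i)

  data SumOption (G H : Game) (x y : Side) : Game → Set where
    left  : ∀ {X} → X ∈ x → SumOption G H x y (X +G H)
    right : ∀ {Y} → Y ∈ y → SumOption G H x y (G +G Y)

  ∈-sumSide⁻¹ : ∀ G H x y {Z} → Z ∈ sumSide G H x y → SumOption G H x y Z
  ∈-sumSide⁻¹ G H (opts n f) (atom _)   (option i) = left (option i)
  ∈-sumSide⁻¹ G H (atom _)   (opts m g) (option j) = right (option j)
  ∈-sumSide⁻¹ G H (opts n f) (opts m g) (option k) with splitAt (suc n) k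
  ... | inj₁ i = left (option i)
  ... | inj₂ j = right (option j)

  ∈-sumSideˡ : ∀ G H {x} y {X} → X ∈ x → (X +G H) ∈ sumSide G H x y
  ∈-sumSideˡ G H (atom _) (option i) = option i
  ∈-sumSideˡ G H {opts n f} (opts m g) (option i) =
    subst (_∈ _) (cong [ (λ i → f i +G H) , (λ j → G +G g j) ]′ (splitAt-↑ˡ (suc n) i (suc m)))
      (option (i ↑ˡ suc m))

  ∈-sumSideʳ : ∀ G H x {y Y} → Y ∈ y → (G +G Y) ∈ sumSide G H x y
  ∈-sumSideʳ G H (atom _) (option j) = option j
  ∈-sumSideʳ G H (opts n f) {opts m g} (option j) =
    subst (_∈ _) (cong [ (λ i → f i +G H) , (λ j → G +G g j) ]′ (splitAt-↑ʳ (suc n) (suc m) j))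
      (option (suc n ↑ʳ j))

  All-sumSide : ∀ {P} G H x y → All (λ X → P (X +G H)) x → All (λ Y → P (G +G Y)) y →
                All P (sumSide G H x y)
  All-sumSide G H x y px py Z∈ with ∈-sumSide⁻¹ G H x y Z∈
  ... | left X∈  = px X∈
  ... | right Y∈ = py Y∈

  sumSide-atom⁻¹ : ∀ {G H} x y {s} → sumSide G H x y ≡ atom s →
                   ∃₂ λ a b → x ≡ atom a × y ≡ atom b × s ≡ a ⊹ b
  sumSide-atom⁻¹ (atom a) (atom b)   refl = a , b , refl , refl , refl
  sumSide-atom⁻¹ (atom _) (opts _ _) ()
  sumSide-atom⁻¹ (opts _ _) (atom _) ()
  sumSide-atom⁻¹ (opts _ _) (opts _ _) ()

  Cover : (Game → Game → Set) → Side → Side → Set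
  Cover R x y = All (λ X → ∃ λ Y → Y ∈ y × R X Y) x

  Cover-sumSide : ∀ {R} G H x y {w} →
    All (λ X → ∃ λ W → W ∈ w × R (X +G H) W) x → All (λ Y → ∃ λ W → W ∈ w × R (G +G Y) W) y →
    Cover R (sumSide G H x y) w
  Cover-sumSide {R} G H x y {w} = All-sumSide {λ Z → ∃ λ W → W ∈ w × R Z W} G H x y

  ≅S-intro : ∀ {x y} → (∀ {a b} → x ≡ atom a → y ≡ atom b → a ≡ b) →
             Cover _≅_ x y → Cover (flip _≅_) y x → x ≅S y
  ≅S-intro {atom a}   {atom b}   atoms _ _ = ≅-atom (atoms refl refl)
  -- Option families are nonempty, so an option side can neither cover nor be covered by an atom.
  ≅S-intro {atom a}   {opts m g} _ _ y⊑x with y⊑x (option zero)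
  ... | _ , () , _
  ≅S-intro {opts n f} {atom b}   _ x⊑y _ with x⊑y (option zero)
  ... | _ , () , _
  ≅S-intro {opts n f} {opts m g} _ x⊑y y⊑x = ≅-opts forth back
    where
    forth : ∀ i → ∃ λ j → f i ≅ g j
    forth i with x⊑y (option i)
    ... | _ , option j , fi≅gj = j , fi≅gj
    back : ∀ j → ∃ λ i → f i ≅ g j
    back j with y⊑x (option j)
    ... | _ , option i , fi≅gj = i , fi≅gj

  sumSide-comm-atoms : ∀ G H x y {s t} → sumSide G H x y ≡ atom s → sumSide H G y x ≡ atom t → s ≡ t
  sumSide-comm-atoms G H x y p q with sumSide-atom⁻¹ x y p
  sumSide-comm-atoms G H _ _ _ refl | a , b , refl , refl , refl = ⊹-comm a b

  sumSide-comm : ∀ G H x y → All (λ X → (X +G H) ≅ (H +G X)) x → All (λ Y → (G +G Y) ≅ (Y +G G)) y →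
                 sumSide G H x y ≅S sumSide H G y x
  sumSide-comm G H x y ihx ihy =
    ≅S-intro (sumSide-comm-atoms G H x y)
      (Cover-sumSide G H x y (λ X∈ → _ , ∈-sumSideʳ H G y X∈ , ihx X∈)
                             (λ Y∈ → _ , ∈-sumSideˡ H G x Y∈ , ihy Y∈))
      (Cover-sumSide H G y x (λ Y∈ → _ , ∈-sumSideʳ G H x Y∈ , ihy Y∈)
                             (λ X∈ → _ , ∈-sumSideˡ G H y X∈ , ihx X∈))

  +G-comm : ∀ G H → (G +G H) ≅ (H +G G)
  +G-comm = Game-ind _ λ ihG-l ihG-r → Game-ind _ λ ihH-l ihH-r →
    ≅-game (sumSide-comm _ _ _ _ (λ X∈ → ihG-l X∈ _) ihH-l)
           (sumSide-comm _ _ _ _ (λ X∈ → ihG-r X∈ _) ihH-r)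

  sumSide-assoc-atoms : ∀ G H J x y z {s t} →
    sumSide (G +G H) J (sumSide G H x y) z ≡ atom s →
    sumSide G (H +G J) x (sumSide H J y z) ≡ atom t → s ≡ t
  sumSide-assoc-atoms G H J x y z p q with sumSide-atom⁻¹ (sumSide G H x y) z p
  ... | _ , _ , xy≡ , refl , refl with sumSide-atom⁻¹ x y xy≡
  sumSide-assoc-atoms G H J _ _ _ _ refl | _ , c , _ , refl , refl | a , b , refl , refl , refl =
    ⊹-assoc a b c

  sumSide-assoc : ∀ G H J x y z →
    All (λ X → ((X +G H) +G J) ≅ (X +G (H +G J))) x →
    All (λ Y → ((G +G Y) +G J) ≅ (G +G (Y +G J))) y →
    All (λ Z → ((G +G H) +G Z) ≅ (G +G (H +G Z))) z →
    sumSide (G +G H) J (sumSide G H x y) z ≅S sumSide G (H +G J) x (sumSide H J y z)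
  sumSide-assoc G H J x y z ihx ihy ihz =
    ≅S-intro (sumSide-assoc-atoms G H J x y z)
      (Cover-sumSide GH J xy z
        (Cover-sumSide G H x y (λ X∈ → _ , ∈-sumSideˡ G HJ yz X∈ , ihx X∈)
                               (λ Y∈ → _ , ∈-sumSideʳ G HJ x (∈-sumSideˡ H J z Y∈) , ihy Y∈))
        (λ Z∈ → _ , ∈-sumSideʳ G HJ x (∈-sumSideʳ H J y Z∈) , ihz Z∈))
      (Cover-sumSide G HJ x yz
        (λ X∈ → _ , ∈-sumSideˡ GH J z (∈-sumSideˡ G H y X∈) , ihx X∈)
        (Cover-sumSide H J y z (λ Y∈ → _ , ∈-sumSideˡ GH J z (∈-sumSideʳ G H x Y∈) , ihy Y∈)
                               (λ Z∈ → _ , ∈-sumSideʳ GH J xy Z∈ , ihz Z∈)))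
    where
    GH HJ : Game
    xy yz : Side
    GH = G +G H
    HJ = H +G J
    xy = sumSide G H x y
    yz = sumSide H J y z

  +G-assoc : ∀ G H J → ((G +G H) +G J) ≅ (G +G (H +G J))
  +G-assoc = Game-ind _ λ ihG-l ihG-r → Game-ind _ λ ihH-l ihH-r → Game-ind _ λ ihJ-l ihJ-r →
    ≅-game (sumSide-assoc _ _ _ _ _ _ (λ X∈ → ihG-l X∈ _ _) (λ Y∈ → ihH-l Y∈ _) ihJ-l)
           (sumSide-assoc _ _ _ _ _ _ (λ X∈ → ihG-r X∈ _ _) (λ Y∈ → ihH-r Y∈ _) ihJ-r)

  sumSide-identityʳ : ∀ G x → All (λ X → (X +G 𝟎) ≅ X) x → sumSide G 𝟎 x (atom 0#) ≅S x
  sumSide-identityʳ G (atom s)   _  = ≅-atom (⊹-identityʳ s)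
  sumSide-identityʳ G (opts n f) ih = ≅-opts (λ i → i , ih (option i)) (λ i → i , ih (option i))

  sumSide-identityˡ : ∀ G x → All (λ X → (𝟎 +G X) ≅ X) x → sumSide 𝟎 G (atom 0#) x ≅S x
  sumSide-identityˡ G (atom s)   _  = ≅-atom (⊹-idˡ s)
  sumSide-identityˡ G (opts n f) ih = ≅-opts (λ i → i , ih (option i)) (λ i → i , ih (option i))

  +G-identityʳ : ∀ G → (G +G 𝟎) ≅ G
  +G-identityʳ = Game-ind _ λ ih-l ih-r → ≅-game (sumSide-identityʳ _ _ ih-l) (sumSide-identityʳ _ _ ih-r)

  +G-identityˡ : ∀ G → (𝟎 +G G) ≅ G
  +G-identityˡ = Game-ind _ λ ih-l ih-r → ≅-game (sumSide-identityˡ _ _ ih-l) (sumSide-identityˡ _ _ ih-r)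

  OccursInSide : S → Side → Set
  OccursInSide s x = x ≡ atom s ⊎ ∃ λ X → X ∈ x × OccursIn s X

  occursIn⁻¹ : ∀ {s l r} → OccursIn s ⟨ l ∣ r ⟩ → OccursInSide s l ⊎ OccursInSide s r
  occursIn⁻¹ here-L     = inj₁ (inj₁ refl)
  occursIn⁻¹ here-R     = inj₂ (inj₁ refl)
  occursIn⁻¹ (in-L i o) = inj₁ (inj₂ (_ , option i , o))
  occursIn⁻¹ (in-R i o) = inj₂ (inj₂ (_ , option i , o))

  occursInˡ : ∀ {s l r} → OccursInSide s l → OccursIn s ⟨ l ∣ r ⟩
  occursInˡ (inj₁ refl)               = here-L
  occursInˡ (inj₂ (_ , option i , o)) = in-L i o

  occursInʳ : ∀ {s l r} → OccursInSide s r → OccursIn s ⟨ l ∣ r ⟩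
  occursInʳ (inj₁ refl)               = here-R
  occursInʳ (inj₂ (_ , option i , o)) = in-R i o

  SumOfAtoms : Game → Game → S → Set
  SumOfAtoms G H s = ∃₂ λ s₁ s₂ → OccursIn s₁ G × OccursIn s₂ H × s ≡ s₁ ⊹ s₂

  SumOfAtoms-mono : ∀ {G G′ H H′ s} →
    (∀ {t} → OccursIn t G → OccursIn t G′) → (∀ {t} → OccursIn t H → OccursIn t H′) →
    SumOfAtoms G H s → SumOfAtoms G′ H′ s
  SumOfAtoms-mono G⊆G′ H⊆H′ (s₁ , s₂ , o₁ , o₂ , s≡) = s₁ , s₂ , G⊆G′ o₁ , H⊆H′ o₂ , s≡

  occursInSide-sumSide⁻¹ : ∀ {G H x y} →
    (∀ {t} → OccursInSide t x → OccursIn t G) → (∀ {t} → OccursInSide t y → OccursIn t H) →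
    All (λ X → ∀ {t} → OccursIn t (X +G H) → SumOfAtoms X H t) x →
    All (λ Y → ∀ {t} → OccursIn t (G +G Y) → SumOfAtoms G Y t) y →
    ∀ {s} → OccursInSide s (sumSide G H x y) → SumOfAtoms G H s
  occursInSide-sumSide⁻¹ {x = x} {y} x⊆G y⊆H _ _ (inj₁ p) with sumSide-atom⁻¹ x y p
  ... | a , b , refl , refl , refl = a , b , x⊆G (inj₁ refl) , y⊆H (inj₁ refl) , refl
  occursInSide-sumSide⁻¹ {G} {H} {x} {y} x⊆G y⊆H ihx ihy (inj₂ (_ , Z∈ , o))
    with ∈-sumSide⁻¹ G H x y Z∈
  ... | left X∈  = SumOfAtoms-mono (λ o₁ → x⊆G (inj₂ (_ , X∈ , o₁))) id (ihx X∈ o)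
  ... | right Y∈ = SumOfAtoms-mono id (λ o₂ → y⊆H (inj₂ (_ , Y∈ , o₂))) (ihy Y∈ o)

  occursIn-+G⁻¹ : ∀ G H {s} → OccursIn s (G +G H) → SumOfAtoms G H s
  occursIn-+G⁻¹ = Game-ind _ λ ihG-l ihG-r → Game-ind _ λ ihH-l ihH-r o →
    [ occursInSide-sumSide⁻¹ occursInˡ occursInˡ (λ X∈ → ihG-l X∈ _) ihH-l
    , occursInSide-sumSide⁻¹ occursInʳ occursInʳ (λ X∈ → ihG-r X∈ _) ihH-r
    ]′ (occursIn⁻¹ o)

  LowerBound UpperBound : S → Game → Set
  LowerBound ℓ K = ∀ s → OccursIn s K → ℓ ≤ s
  UpperBound r K = ∀ s → OccursIn s K → s ≤ r

  +G-lowerBound : ∀ {G H ℓ₁ ℓ₂} → LowerBound ℓ₁ G → LowerBound ℓ₂ H → LowerBound (ℓ₁ ⊹ ℓ₂) (G +G H)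
  +G-lowerBound {G} {H} ℓ₁≤G ℓ₂≤H s o with occursIn-+G⁻¹ G H o
  ... | s₁ , s₂ , o₁ , o₂ , refl = ⊹-mono-≤ (ℓ₁≤G s₁ o₁) (ℓ₂≤H s₂ o₂)

  +G-upperBound : ∀ {G H r₁ r₂} → UpperBound r₁ G → UpperBound r₂ H → UpperBound (r₁ ⊹ r₂) (G +G H)
  +G-upperBound {G} {H} G≤r₁ H≤r₂ s o with occursIn-+G⁻¹ G H o
  ... | s₁ , s₂ , o₁ , o₂ , refl = ⊹-mono-≤ (G≤r₁ s₁ o₁) (H≤r₂ s₂ o₂)

  GuaranteedRoot : Game → Set
  GuaranteedRoot K = (∀ ℓ → leftSide K ≡ atom ℓ → LowerBound ℓ K)
                   × (∀ r → rightSide K ≡ atom r → UpperBound r K)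

  guaranteed-intro : ∀ {l r} → GuaranteedRoot ⟨ l ∣ r ⟩ → All Guaranteed l → All Guaranteed r →
                     Guaranteed ⟨ l ∣ r ⟩
  guaranteed-intro root _  _  _ self         = root
  guaranteed-intro _    gl _  K (via-L i fo) = gl (option i) K fo
  guaranteed-intro _    _  gr K (via-R i fo) = gr (option i) K fo

  guaranteed-root : ∀ {G} → Guaranteed G → GuaranteedRoot G
  guaranteed-root gG = gG _ self

  guaranteed-optionsˡ : ∀ {l r} → Guaranteed ⟨ l ∣ r ⟩ → All Guaranteed l
  guaranteed-optionsˡ g (option i) K fo = g K (via-L i fo)

  guaranteed-optionsʳ : ∀ {l r} → Guaranteed ⟨ l ∣ r ⟩ → All Guaranteed r
  guaranteed-optionsʳ g (option i) K fo = g K (via-R i fo)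

  +G-guaranteedRoot : ∀ G H → Guaranteed G → Guaranteed H → GuaranteedRoot (G +G H)
  +G-guaranteedRoot G@(⟨ a ∣ b ⟩) H@(⟨ c ∣ d ⟩) gG gH = lower , upper
    where
    lower : ∀ ℓ → sumSide G H a c ≡ atom ℓ → LowerBound ℓ (G +G H)
    lower ℓ p with sumSide-atom⁻¹ a c p
    ... | ℓ₁ , ℓ₂ , a≡ , c≡ , refl =
      +G-lowerBound (proj₁ (guaranteed-root gG) ℓ₁ a≡) (proj₁ (guaranteed-root gH) ℓ₂ c≡)
    upper : ∀ r → sumSide G H b d ≡ atom r → UpperBound r (G +G H)
    upper r p with sumSide-atom⁻¹ b d p
    ... | r₁ , r₂ , b≡ , d≡ , refl =
      +G-upperBound (proj₂ (guaranteed-root gG) r₁ b≡) (proj₂ (guaranteed-root gH) r₂ d≡)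

  +G-guaranteed : ∀ G H → Guaranteed G → Guaranteed H → Guaranteed (G +G H)
  +G-guaranteed = Game-ind _ λ ihG-l ihG-r → Game-ind _ λ ihH-l ihH-r gG gH →
    guaranteed-intro (+G-guaranteedRoot _ _ gG gH)
      (All-sumSide _ _ _ _ (λ X∈ → ihG-l X∈ _ (guaranteed-optionsˡ gG X∈) gH)
                           (λ Y∈ → ihH-l Y∈ gG (guaranteed-optionsˡ gH Y∈)))
      (All-sumSide _ _ _ _ (λ X∈ → ihG-r X∈ _ (guaranteed-optionsʳ gG X∈) gH)
                           (λ Y∈ → ihH-r Y∈ gG (guaranteed-optionsʳ gH Y∈)))

theorem6 : (SG : ScoreGroup) → let open Games SG in
    (G H J : Game) → Guaranteed G → Guaranteed H → Guaranteed J →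
      Guaranteed (G +G H)
    × (G +G H) ≅ (H +G G)
    × ((G +G H) +G J) ≅ (G +G (H +G J))
    × (G +G 𝟎) ≅ G
    × (𝟎 +G G) ≅ G
-- Only closure uses guaranteedness: the monoid laws hold for all games.
theorem6 SG G H J gG gH _ =
  +G-guaranteed G H gG gH , +G-comm G H , +G-assoc G H J , +G-identityʳ G , +G-identityˡ G
  where open GameSum SG
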